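{- Let $G$ be a $P_9$-free chordal graph and $a\in RN(G)$. Then $a$ is partially adjacent to at most one irredundant component of $G$; that is, for all irredundant components $C$ of $G$ except at most one, either $C\cap N(a)=\emptyset$ or $C\subseteq N(a)$.
   Context: All graphs are finite, simple and undirected; $N(x)$ and $N[x]$ are the open and closed neighbourhoods of $x$. A vertex $x$ is irredundant if $N[x]$ is inclusion-minimal in $\{N[y]:y\in V(G)\}$, with the convention that among several vertices having the same inclusion-minimal closed neighbourhood exactly one (fixed) is declared irredundant; all other vertices are redundant. $IR(G)$, $RN(G)$ are the sets of irredundant and redundant vertices; an irredundant component is the vertex set of a connected component of $G[IR(G)]$. A vertex $x$ is partially adjacent to a set $X$ if it is adjacent to some element of $X$ but $X\not\subseteq N(x)$. $P_9$-free means no induced path on $9$ vertices; chordal means no induced cycle of length at least four. -}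

module Defs where

open import Data.Nat using (ℕ; zero; suc; _≤_; _∸_)
open import Data.Fin using (Fin; toℕ)
open import Data.Bool using (Bool; true)
open import Data.Product using (Σ; ∃; _×_; _,_)
open import Data.Sum using (_⊎_)
open import Relation.Nullary using (¬_)
open import Relation.Binary.PropositionalEquality using (_≡_)
open import Function.Definitions using (Injective)

record Graph : Set where
  field
    n      : ℕ
    adj    : Fin n → Fin n → Bool
    sym    : ∀ x y → adj x y ≡ adj y x
    irrefl : ∀ x → ¬ (adj x x ≡ true)
open Graph public

Vertex : Graph → Set
Vertex G = Fin (n G)

Adj : (G : Graph) → Vertex G → Vertex G → Set
Adj G x y = adj G x y ≡ true

VSet : Graph → Set₁
VSet G = Vertex G → Set

NC : (G : Graph) → Vertex G → VSet G
NC G x y = x ≡ y ⊎ Adj G x y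

_⊆_ : {G : Graph} → VSet G → VSet G → Set
_⊆_ {G} A B = ∀ (z : Vertex G) → A z → B z

MinimalNC : (G : Graph) → Vertex G → Set
MinimalNC G x = ∀ y → _⊆_ {G} (NC G y) (NC G x) → _⊆_ {G} (NC G x) (NC G y)

SameNC : (G : Graph) → Vertex G → Vertex G → Set
SameNC G x y = _⊆_ {G} (NC G x) (NC G y) × _⊆_ {G} (NC G y) (NC G x)

-- A valid choice of the set of irredundant vertices: exactly the vertices with
-- inclusion-minimal closed neighbourhood, with exactly one (arbitrary, fixed)
-- representative per class of equal minimal closed neighbourhoods.
record IsIRChoice (G : Graph) (IR : VSet G) : Set where
  field
    ir-minimal : ∀ x → IR x → MinimalNC G x
    ir-covers  : ∀ x → MinimalNC G x → ∃ λ y → IR y × SameNC G y x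
    ir-unique  : ∀ x y → IR x → IR y → SameNC G x y → x ≡ y

data WalkIn (G : Graph) (S : VSet G) : Vertex G → Vertex G → Set where
  here : ∀ {x} → S x → WalkIn G S x x
  step : ∀ {x y z} → WalkIn G S x y → Adj G y z → S z → WalkIn G S x z

ComponentOf : (G : Graph) → VSet G → Vertex G → VSet G
ComponentOf G S r x = WalkIn G S r x

PartiallyAdjacent : (G : Graph) → Vertex G → VSet G → Set
PartiallyAdjacent G x X =
  (∃ λ y → X y × Adj G x y) × ¬ (∀ y → X y → Adj G x y)

PathAdj : ∀ {k} → Fin k → Fin k → Set
PathAdj i j = suc (toℕ i) ≡ toℕ j ⊎ suc (toℕ j) ≡ toℕ i

CycleAdj : ∀ k → Fin k → Fin k → Set
CycleAdj k i j = PathAdj i j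
  ⊎ (toℕ i ≡ 0 × toℕ j ≡ k ∸ 1) ⊎ (toℕ j ≡ 0 × toℕ i ≡ k ∸ 1)

InducedCopy : (G : Graph) (k : ℕ) → (Fin k → Fin k → Set) → Set
InducedCopy G k R = Σ (Fin k → Vertex G) λ f →
  Injective _≡_ _≡_ f ×
  (∀ i j → (Adj G (f i) (f j) → R i j) × (R i j → Adj G (f i) (f j)))

P9Free : Graph → Set
P9Free G = ¬ InducedCopy G 9 PathAdj

Chordal : Graph → Set
Chordal G = ∀ k → 4 ≤ k → ¬ InducedCopy G k (CycleAdj k)

module Submission where

-- If a is partially adjacent to the component of r, walking inside that
-- component from a neighbour of a to a non-neighbour crosses an irredundant edge
-- xy with a ~ x and a ≁ y (a boundary edge).  Irredundance of x and y gives
-- private neighbours extending a–x–y to a path a–x–y–y₁–z, and chordality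
-- (no induced C₄ or C₅) makes this path induced.  Given two such tails for two
-- components, either an edge between {x,y} and {x',y'} joins the components, or
-- the cross edge nearest to a closes an induced cycle of length ≥ 5, or there is
-- no cross edge and the two tails form an induced P₉.

open import Defs hiding (sym)
open import Data.Nat as ℕ using (_≤?_; _∸_)
open import Data.Nat.Properties using (≤-refl)
open import Data.Fin using (Fin; zero; suc; toℕ; _≟_)
open import Data.Fin.Patterns using (0F; 1F; 2F; 3F; 4F)
open import Data.Fin.Properties using (all?; any?)
open import Data.Fin.Subset as Subset using (Subset; _∈_; _∉_; _∪_; ⁅_⁆)
open import Data.Fin.Subset.Properties
  using (_∈?_; p⊆p∪q; x∈p∪q⁺; x∈p∪q⁻; x∈⁅x⁆; x∈⁅y⁆⇒x≡y)
open import Data.Fin.Subset.Induction using (⊃-wellFounded)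
open import Induction.WellFounded using (Acc; acc)
open import Data.Bool using (Bool; true; false)
open import Data.Bool.Properties using (¬-not) renaming (_≟_ to _≟ᵇ_)
open import Data.Vec using (Vec; _∷_; []; lookup; tabulate; allFin)
open import Data.Vec.Properties using (lookup∘tabulate)
open import Data.Product using (Σ; ∃; ∃₂; _×_; _,_)
open import Data.Sum using (_⊎_; inj₁; inj₂)
open import Data.Empty using (⊥; ⊥-elim)
open import Data.Unit using (tt)
open import Function using (_∘_)
open import Function.Definitions using (Injective)
open import Relation.Nullary using (¬_; Dec; yes; no; does; ¬?)
open import Relation.Nullary.Decidable
  using (True; toWitness; dec-true; decidable-stable; _×-dec_; _⊎-dec_; _→-dec_)
open import Relation.Binary.PropositionalEquality
  using (_≡_; _≢_; refl; sym; trans; cong; subst; module ≡-Reasoning)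

does⇒ : {A : Set} (a? : Dec A) → does a? ≡ true → A
does⇒ (yes a) _ = a
does⇒ (no _) ()

⊈-witness : ∀ {n} {P Q : Fin n → Set} → (∀ z → Dec (P z)) → (∀ z → Dec (Q z)) →
  ¬ (∀ z → P z → Q z) → ∃ λ z → P z × ¬ Q z
⊈-witness P? Q? P⊈Q with any? (λ z → P? z ×-dec ¬? (Q? z))
... | yes witness = witness
... | no none = ⊥-elim (P⊈Q λ z pz → decidable-stable (Q? z) λ ¬qz → none (z , pz , ¬qz))

pathAdj? : ∀ {k} (i j : Fin k) → Dec (PathAdj i j)
pathAdj? i j = (ℕ.suc (toℕ i) ℕ.≟ toℕ j) ⊎-dec (ℕ.suc (toℕ j) ℕ.≟ toℕ i)

cycleAdj? : ∀ k (i j : Fin k) → Dec (CycleAdj k i j)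
cycleAdj? k i j = pathAdj? i j
  ⊎-dec (toℕ i ℕ.≟ 0 ×-dec toℕ j ℕ.≟ k ∸ 1) ⊎-dec (toℕ j ℕ.≟ 0 ×-dec toℕ i ℕ.≟ k ∸ 1)

-- A pattern separates points if distinct points have distinct neighbourhoods;
-- a realisation of such a pattern is automatically injective.
Separating : ∀ {m} → (Fin m → Fin m → Set) → Set
Separating R = ∀ i j → i ≡ j ⊎ (∃ λ k → R i k × ¬ R j k) ⊎ (∃ λ k → ¬ R i k × R j k)

separating? : ∀ {m} {R : Fin m → Fin m → Set} → (∀ i j → Dec (R i j)) → Dec (Separating R)
separating? R? = all? λ i → all? λ j → i ≟ j
  ⊎-dec any? (λ k → R? i k ×-dec ¬? (R? j k)) ⊎-dec any? (λ k → ¬? (R? i k) ×-dec R? j k)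

Table : Set → Set
Table P = P → P → Bool

Shows : ∀ {P : Set} {m} {R : Fin m → Fin m → Set} → Table P → Vec P m → (∀ i j → Dec (R i j)) → Set
Shows M idx R? = ∀ i j → M (lookup idx i) (lookup idx j) ≡ does (R? i j)

shows? : ∀ {P : Set} {m} {R : Fin m → Fin m → Set} (M : Table P) (idx : Vec P m)
  (R? : ∀ i j → Dec (R i j)) → Dec (Shows M idx R?)
shows? M idx R? = all? λ i → all? λ j → M (lookup idx i) (lookup idx j) ≟ᵇ does (R? i j)

path5 : Bool → Table (Fin 5)
path5 b 0F 4F = b
path5 b 4F 0F = b
path5 b i j = does (pathAdj? i j)

-- Positions of two 5-vertex paths glued at their vertex 0.
data Pos : Set where
  left right : Fin 5 → Pos

-- Adjacency between the two glued paths: vertex 0 is shared, the cross pairs of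
-- the remaining vertices are read off the 4 × 4 matrix C.
crossTable : Vec (Vec Bool 4) 4 → Fin 5 → Fin 5 → Bool
crossTable C zero j = path5 false zero j
crossTable C (suc i) zero = path5 false (suc i) zero
crossTable C (suc i) (suc j) = lookup (lookup C i) j

gluedTable : Vec (Vec Bool 4) 4 → Table Pos
gluedTable C (left i) (left j) = path5 false i j
gluedTable C (right i) (right j) = path5 false i j
gluedTable C (left i) (right j) = crossTable C i j
gluedTable C (right i) (left j) = crossTable C j i

Forced : Vec (Vec Bool 4) 4 → Set
Forced C = lookup (lookup C 0F) 0F ≡ false × lookup (lookup C 0F) 1F ≡ false
         × lookup (lookup C 1F) 0F ≡ false × lookup (lookup C 1F) 1F ≡ false

module _ (G : Graph) where

  private
    V : Set
    V = Vertex G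

    variable
      S : VSet G
      a r r′ x y z u v w : V
      b : Bool

  swap : adj G x y ≡ b → adj G y x ≡ b
  swap {x} {y} e = trans (Graph.sym G y x) e

  adj? : ∀ x y → Dec (Adj G x y)
  adj? x y = adj G x y ≟ᵇ true

  noLoop : ∀ x → adj G x x ≡ false
  noLoop x = ¬-not (irrefl G x)

  adjacent⇒distinct : Adj G x y → x ≢ y
  adjacent⇒distinct {x} xy refl = irrefl G x xy

  walkStart : WalkIn G S x y → S x
  walkStart (here sx) = sx
  walkStart (step w _ _) = walkStart w

  walkEnd : WalkIn G S x y → S y
  walkEnd (here sx) = sx
  walkEnd (step _ _ sz) = sz

  _++ʷ_ : WalkIn G S x y → WalkIn G S y z → WalkIn G S x z
  w ++ʷ here _ = w
  w ++ʷ step w′ e s = step (w ++ʷ w′) e s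

  reverseʷ : WalkIn G S x y → WalkIn G S y x
  reverseʷ (here s) = here s
  reverseʷ (step w yz sz) = step (here sz) (swap yz) (walkEnd w) ++ʷ reverseʷ w

  joinAt : WalkIn G S r u → WalkIn G S r′ v → Adj G u v → WalkIn G S r r′
  joinAt ru r′v uv = step ru uv (walkEnd r′v) ++ʷ reverseʷ r′v

  -- Reachability inside a decidable vertex set is decidable: grow the set of
  -- vertices known to be reachable along exiting edges until it is closed.
  module Reachability (S : VSet G) (S? : ∀ x → Dec (S x)) (r : V) where

    Reached : Subset (n G) → Set
    Reached p = ∀ x → x ∈ p → WalkIn G S r x

    Exit : Subset (n G) → Set
    Exit p = ∃ λ u → ∃ λ v → u ∈ p × Adj G u v × S v × v ∉ p

    exit? : ∀ p → Dec (Exit p)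
    exit? p = any? λ u → any? λ v → u ∈? p ×-dec adj? u v ×-dec S? v ×-dec ¬? (v ∈? p)

    -- terminates because the reached set strictly grows
    saturate : ∀ p → Acc Subset._⊃_ p → Reached p →
      Σ (Subset (n G)) λ q → Reached q × ¬ Exit q × p Subset.⊆ q
    saturate p (acc larger) reached with exit? p
    ... | no closed = p , reached , closed , λ x∈p → x∈p
    ... | yes (u , v , u∈p , uv , sv , v∉p)
      with saturate (p ∪ ⁅ v ⁆) (larger grows) reached′
      where
        grows : p Subset.⊂ p ∪ ⁅ v ⁆
        grows = p⊆p∪q _ , v , x∈p∪q⁺ (inj₂ (x∈⁅x⁆ v)) , v∉p
        reached′ : Reached (p ∪ ⁅ v ⁆)
        reached′ x x∈ with x∈p∪q⁻ p ⁅ v ⁆ x∈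
        ... | inj₁ x∈p = reached x x∈p
        ... | inj₂ x∈v rewrite x∈⁅y⁆⇒x≡y v x∈v = step (reached u u∈p) uv sv
    ... | q , reachedq , closedq , p∪v⊆q = q , reachedq , closedq , p∪v⊆q ∘ p⊆p∪q _

    closed⇒contains : ∀ q → ¬ Exit q → r ∈ q → WalkIn G S r x → x ∈ q
    closed⇒contains q closed r∈q (here _) = r∈q
    closed⇒contains q closed r∈q (step {y = u} {z = v} ru uv sv) with v ∈? q
    ... | yes v∈q = v∈q
    ... | no v∉q = ⊥-elim (closed (u , v , closed⇒contains q closed r∈q ru , uv , sv , v∉q))

    walk? : ∀ x → Dec (WalkIn G S r x)
    walk? x with S? r
    ... | no r∉S = no λ w → r∉S (walkStart w)
    ... | yes r∈S with saturate ⁅ r ⁆ (⊃-wellFounded _) reachedr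
      where
        reachedr : Reached ⁅ r ⁆
        reachedr y y∈ rewrite x∈⁅y⁆⇒x≡y r y∈ = here r∈S
    ... | q , reached , closed , r⊆q with x ∈? q
    ... | yes x∈q = yes (reached x x∈q)
    ... | no x∉q = no λ w → x∉q (closed⇒contains q closed (r⊆q (x∈⁅x⁆ r)) w)

  open Reachability using (walk?)

  BoundaryEdge : VSet G → V → V → Set
  BoundaryEdge S a r = ∃₂ λ x y →
    WalkIn G S r x × WalkIn G S r y × Adj G x y × Adj G a x × ¬ Adj G a y

  propagate : WalkIn G S r u → Adj G a u → WalkIn G S u v → Adj G a v ⊎ BoundaryEdge S a r
  propagate ru au (here _) = inj₁ au
  propagate {a = a} ru au (step {y = w} {z = v} uw wv sv) with propagate ru au uw | adj? a v
  ... | inj₂ edge | _ = inj₂ edge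
  ... | inj₁ _ | yes av = inj₁ av
  ... | inj₁ aw | no ¬av = inj₂ (w , v , ru ++ʷ uw , step (ru ++ʷ uw) wv sv , wv , aw , ¬av)

  boundaryEdge : (∀ x → Dec (S x)) → PartiallyAdjacent G a (ComponentOf G S r) → BoundaryEdge S a r
  boundaryEdge {S} {a} {r} S? ((u , ru , au) , notAll) with ⊈-witness (walk? S S? r) (adj? a) notAll
  ... | v , rv , ¬av with propagate ru au (reverseʷ ru ++ʷ rv)
  ... | inj₁ av = ⊥-elim (¬av av)
  ... | inj₂ edge = edge

  N[_]⊆N[_] : V → V → Set
  N[ x ]⊆N[ y ] = _⊆_ {G} (NC G x) (NC G y)

  NC? : ∀ x y → Dec (NC G x y)
  NC? x y = x ≟ y ⊎-dec adj? x y

  ⊆? : ∀ x y → Dec N[ x ]⊆N[ y ]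
  ⊆? x y = all? λ z → NC? x z →-dec NC? y z

  minimal? : ∀ x → Dec (MinimalNC G x)
  minimal? x = all? λ y → ⊆? y x →-dec ⊆? x y

  privateNeighbour : NC G x v → ¬ N[ v ]⊆N[ x ] → ∃ λ u → Adj G v u × x ≢ u × ¬ Adj G x u
  privateNeighbour {x} {v} xv v⊈x with ⊈-witness (NC? v) (NC? x) v⊈x
  ... | u , vu , ¬xu = u , neighbour vu , ¬xu ∘ inj₁ , ¬xu ∘ inj₂
    where
      neighbour : NC G v u → Adj G v u
      neighbour (inj₂ vu) = vu
      neighbour (inj₁ refl) = ⊥-elim (¬xu xv)

  outsideNC : x ≢ y → ¬ Adj G x y → ¬ NC G y x
  outsideNC x≢y ¬xy (inj₁ y≡x) = x≢y (sym y≡x)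
  outsideNC x≢y ¬xy (inj₂ yx) = ¬xy (swap yx)

  minimal⇒notBelow : MinimalNC G x → NC G x w → ¬ NC G v w → ¬ N[ v ]⊆N[ x ]
  minimal⇒notBelow {v = v} minx xw ¬vw v⊆x = ¬vw (minx v v⊆x _ xw)

  Realises : {P : Set} → (P → V) → Table P → Set
  Realises g M = ∀ p q → adj G (g p) (g q) ≡ M p q

  module _ {m} {R : Fin m → Fin m → Set} (R? : ∀ i j → Dec (R i j)) {f : Fin m → V}
           (table : Realises f (λ i j → does (R? i j))) where

    reflectsR : ∀ {i j} → Adj G (f i) (f j) → R i j
    reflectsR {i} {j} e = does⇒ (R? i j) (trans (sym (table i j)) e)

    preservesR : ∀ {i j} → R i j → Adj G (f i) (f j)
    preservesR {i} {j} rij = trans (table i j) (dec-true (R? i j) rij)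

    inducedCopy : Injective _≡_ _≡_ f → InducedCopy G m R
    inducedCopy injective = f , injective , λ i j → reflectsR , preservesR

    separating⇒injective : Separating R → Injective _≡_ _≡_ f
    separating⇒injective separating {i} {j} fi≡fj with separating i j
    ... | inj₁ i≡j = i≡j
    ... | inj₂ (inj₁ (k , ik , ¬jk)) =
      ⊥-elim (¬jk (reflectsR (subst (λ t → Adj G t (f k)) fi≡fj (preservesR ik))))
    ... | inj₂ (inj₂ (k , ¬ik , jk)) =
      ⊥-elim (¬ik (reflectsR (subst (λ t → Adj G t (f k)) (sym fi≡fj) (preservesR jk))))

  patternIn : ∀ {P : Set} {g : P → V} {M : Table P} {m} {R : Fin m → Fin m → Set}
    (R? : ∀ i j → Dec (R i j)) → Realises g M → (idx : Vec P m) →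
    Shows M idx R? → Separating R → InducedCopy G m R
  patternIn {g = g} R? realised idx shows separating =
    inducedCopy R? table (separating⇒injective R? table separating)
    where
      table : Realises (g ∘ lookup idx) (λ i j → does (R? i j))
      table i j = trans (realised _ _) (shows i j)

  cycleIn : Chordal G → ∀ {P : Set} {g : P → V} {M : Table P} → Realises g M → ∀ {m} (idx : Vec P m) →
    True (4 ≤? m ×-dec shows? M idx (cycleAdj? m) ×-dec separating? (cycleAdj? m)) → ⊥
  cycleIn chordal realised {m} idx ok with toWitness ok
  ... | 4≤m , shows , separating = chordal m 4≤m (patternIn (cycleAdj? m) realised idx shows separating)

  pathIn : P9Free G → ∀ {P : Set} {g : P → V} {M : Table P} → Realises g M → (idx : Vec P 9) →
    True (shows? M idx pathAdj? ×-dec separating? pathAdj?) → ⊥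
  pathIn p9free realised idx ok with toWitness ok
  ... | shows , separating = p9free (patternIn pathAdj? realised idx shows separating)

  noInducedC4 : Chordal G → x ≢ z → y ≢ w → Adj G x y → Adj G y z → Adj G z w → Adj G w x →
    adj G x z ≡ false → adj G y w ≡ false → ⊥
  noInducedC4 {x = x} {z = z} {y = y} {w = w} chordal x≢z y≢w xy yz zw wx xz yw =
    chordal 4 ≤-refl (inducedCopy (cycleAdj? 4) table injective)
    where
      f : Fin 4 → V
      f = lookup (x ∷ y ∷ z ∷ w ∷ [])
      table : Realises f (λ i j → does (cycleAdj? 4 i j))
      table 0F 0F = noLoop x
      table 0F 1F = xy
      table 0F 2F = xz
      table 0F 3F = swap wx
      table 1F 0F = swap xy
      table 1F 1F = noLoop y
      table 1F 2F = yz
      table 1F 3F = yw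
      table 2F 0F = swap xz
      table 2F 1F = swap yz
      table 2F 2F = noLoop z
      table 2F 3F = zw
      table 3F 0F = wx
      table 3F 1F = swap yw
      table 3F 2F = swap zw
      table 3F 3F = noLoop w
      -- cycle neighbours are distinct as G has no loops, opposite ones by hypothesis
      injective : Injective _≡_ _≡_ f
      injective {0F} {0F} _ = refl
      injective {0F} {1F} e = ⊥-elim (adjacent⇒distinct (table 0F 1F) e)
      injective {0F} {2F} e = ⊥-elim (x≢z e)
      injective {0F} {3F} e = ⊥-elim (adjacent⇒distinct (table 0F 3F) e)
      injective {1F} {0F} e = ⊥-elim (adjacent⇒distinct (table 1F 0F) e)
      injective {1F} {1F} _ = refl
      injective {1F} {2F} e = ⊥-elim (adjacent⇒distinct (table 1F 2F) e)
      injective {1F} {3F} e = ⊥-elim (y≢w e)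
      injective {2F} {0F} e = ⊥-elim (x≢z (sym e))
      injective {2F} {1F} e = ⊥-elim (adjacent⇒distinct (table 2F 1F) e)
      injective {2F} {2F} _ = refl
      injective {2F} {3F} e = ⊥-elim (adjacent⇒distinct (table 2F 3F) e)
      injective {3F} {0F} e = ⊥-elim (adjacent⇒distinct (table 3F 0F) e)
      injective {3F} {1F} e = ⊥-elim (y≢w (sym e))
      injective {3F} {2F} e = ⊥-elim (adjacent⇒distinct (table 3F 2F) e)
      injective {3F} {3F} _ = refl

  realisesPath5 : ∀ v₀ v₁ v₂ v₃ v₄ →
    Adj G v₀ v₁ → Adj G v₁ v₂ → Adj G v₂ v₃ → Adj G v₃ v₄ →
    adj G v₀ v₂ ≡ false → adj G v₀ v₃ ≡ false → adj G v₁ v₃ ≡ false →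
    adj G v₁ v₄ ≡ false → adj G v₂ v₄ ≡ false → adj G v₀ v₄ ≡ b →
    Realises (lookup (v₀ ∷ v₁ ∷ v₂ ∷ v₃ ∷ v₄ ∷ [])) (path5 b)
  realisesPath5 v₀ v₁ v₂ v₃ v₄ e01 e12 e23 e34 n02 n03 n13 n14 n24 c04 = table
    where
      table : Realises (lookup (v₀ ∷ v₁ ∷ v₂ ∷ v₃ ∷ v₄ ∷ [])) (path5 _)
      table 0F 0F = noLoop v₀
      table 0F 1F = e01
      table 0F 2F = n02
      table 0F 3F = n03
      table 0F 4F = c04
      table 1F 0F = swap e01
      table 1F 1F = noLoop v₁
      table 1F 2F = e12
      table 1F 3F = n13
      table 1F 4F = n14
      table 2F 0F = swap n02
      table 2F 1F = swap e12
      table 2F 2F = noLoop v₂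
      table 2F 3F = e23
      table 2F 4F = n24
      table 3F 0F = swap n03
      table 3F 1F = swap n13
      table 3F 2F = swap e23
      table 3F 3F = noLoop v₃
      table 3F 4F = e34
      table 4F 0F = swap c04
      table 4F 1F = swap n14
      table 4F 2F = swap n24
      table 4F 3F = swap e34
      table 4F 4F = noLoop v₄

  InducedPath5 : Vec V 5 → Set
  InducedPath5 v = Realises (lookup v) (path5 false)

  -- In a chordal graph the ends of such a path are not adjacent: that would be an induced C₅.
  chordalPath5 : Chordal G → {v : Vec V 5} → Realises (lookup v) (path5 b) → InducedPath5 v
  chordalPath5 {b = false} _ realised = realised
  chordalPath5 {b = true} chordal realised = ⊥-elim (cycleIn chordal realised (allFin 5) tt)

  gluedMap : V → Vec V 4 → Vec V 4 → Pos → V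
  gluedMap a L R (left i) = lookup (a ∷ L) i
  gluedMap a L R (right i) = lookup (a ∷ R) i

  crossMatrix : Vec V 4 → Vec V 4 → Vec (Vec Bool 4) 4
  crossMatrix L R = tabulate λ i → tabulate λ j → adj G (lookup L i) (lookup R j)

  realisesGlued : ∀ {L R} → InducedPath5 (a ∷ L) → InducedPath5 (a ∷ R) →
    Realises (gluedMap a L R) (gluedTable (crossMatrix L R))
  realisesGlued {a = a} {L} {R} pL pR = table
    where
      entry : Fin 4 → Fin 4 → Bool
      entry i j = adj G (lookup L i) (lookup R j)
      cross : ∀ i j → adj G (lookup (a ∷ L) i) (lookup (a ∷ R) j) ≡ crossTable (crossMatrix L R) i j
      cross zero j = pR zero j
      cross (suc i) zero = pL (suc i) zero
      cross (suc i) (suc j) = sym (begin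
        lookup (lookup (crossMatrix L R) i) j ≡⟨ cong (λ row → lookup row j) (lookup∘tabulate (tabulate ∘ entry) i) ⟩
        lookup (tabulate (entry i)) j         ≡⟨ lookup∘tabulate (entry i) j ⟩
        entry i j                             ∎)
        where open ≡-Reasoning
      table : Realises (gluedMap a L R) (gluedTable (crossMatrix L R))
      table (left i) (left j) = pL i j
      table (right i) (right j) = pR i j
      table (left i) (right j) = cross i j
      table (right i) (left j) = swap (cross j i)

  -- Rows of C are x, y, y₁, z of the left tail, columns those of the
  -- right tail; the cross edge nearest to a closes an induced cycle of length ≥ 5
  -- through a, and without cross edges the tails form an induced P₉.
  glued : Chordal G → P9Free G → ∀ {g : Pos → V} (C : Vec (Vec Bool 4) 4) → Forced C →
    Realises g (gluedTable C) → ⊥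
  glued chordal p9free
    ((_     ∷ _     ∷ _     ∷ _     ∷ []) ∷
     (_     ∷ _     ∷ _     ∷ _     ∷ []) ∷
     (true  ∷ _     ∷ _     ∷ _     ∷ []) ∷
     (_     ∷ _     ∷ _     ∷ _     ∷ []) ∷ []) (refl , refl , refl , refl) realised =
    cycleIn chordal realised (left 0F ∷ left 1F ∷ left 2F ∷ left 3F ∷ right 1F ∷ []) tt
  glued chordal p9free
    ((_     ∷ _     ∷ true  ∷ _     ∷ []) ∷
     (_     ∷ _     ∷ _     ∷ _     ∷ []) ∷
     (_     ∷ _     ∷ _     ∷ _     ∷ []) ∷
     (_     ∷ _     ∷ _     ∷ _     ∷ []) ∷ []) (refl , refl , refl , refl) realised =
    cycleIn chordal realised (left 0F ∷ left 1F ∷ right 3F ∷ right 2F ∷ right 1F ∷ []) tt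
  glued chordal p9free
    ((_     ∷ _     ∷ _     ∷ _     ∷ []) ∷
     (_     ∷ _     ∷ _     ∷ _     ∷ []) ∷
     (false ∷ true  ∷ _     ∷ _     ∷ []) ∷
     (_     ∷ _     ∷ _     ∷ _     ∷ []) ∷ []) (refl , refl , refl , refl) realised =
    cycleIn chordal realised (left 0F ∷ left 1F ∷ left 2F ∷ left 3F ∷ right 2F ∷ right 1F ∷ []) tt
  glued chordal p9free
    ((_     ∷ _     ∷ false ∷ _     ∷ []) ∷
     (_     ∷ _     ∷ true  ∷ _     ∷ []) ∷
     (_     ∷ _     ∷ _     ∷ _     ∷ []) ∷
     (_     ∷ _     ∷ _     ∷ _     ∷ []) ∷ []) (refl , refl , refl , refl) realised =
    cycleIn chordal realised (left 0F ∷ left 1F ∷ left 2F ∷ right 3F ∷ right 2F ∷ right 1F ∷ []) tt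
  glued chordal p9free
    ((_     ∷ _     ∷ _     ∷ _     ∷ []) ∷
     (_     ∷ _     ∷ _     ∷ _     ∷ []) ∷
     (false ∷ _     ∷ _     ∷ _     ∷ []) ∷
     (true  ∷ _     ∷ _     ∷ _     ∷ []) ∷ []) (refl , refl , refl , refl) realised =
    cycleIn chordal realised (left 0F ∷ left 1F ∷ left 2F ∷ left 3F ∷ left 4F ∷ right 1F ∷ []) tt
  glued chordal p9free
    ((_     ∷ _     ∷ false ∷ true  ∷ []) ∷
     (_     ∷ _     ∷ _     ∷ _     ∷ []) ∷
     (_     ∷ _     ∷ _     ∷ _     ∷ []) ∷
     (_     ∷ _     ∷ _     ∷ _     ∷ []) ∷ []) (refl , refl , refl , refl) realised =
    cycleIn chordal realised (left 0F ∷ left 1F ∷ right 4F ∷ right 3F ∷ right 2F ∷ right 1F ∷ []) tt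
  glued chordal p9free
    ((_     ∷ _     ∷ false ∷ _     ∷ []) ∷
     (_     ∷ _     ∷ false ∷ _     ∷ []) ∷
     (false ∷ false ∷ true  ∷ _     ∷ []) ∷
     (_     ∷ _     ∷ _     ∷ _     ∷ []) ∷ []) (refl , refl , refl , refl) realised =
    cycleIn chordal realised (left 0F ∷ left 1F ∷ left 2F ∷ left 3F ∷ right 3F ∷ right 2F ∷ right 1F ∷ []) tt
  glued chordal p9free
    ((_     ∷ _     ∷ _     ∷ _     ∷ []) ∷
     (_     ∷ _     ∷ _     ∷ _     ∷ []) ∷
     (false ∷ false ∷ _     ∷ _     ∷ []) ∷
     (false ∷ true  ∷ _     ∷ _     ∷ []) ∷ []) (refl , refl , refl , refl) realised =
    cycleIn chordal realised (left 0F ∷ left 1F ∷ left 2F ∷ left 3F ∷ left 4F ∷ right 2F ∷ right 1F ∷ []) tt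
  glued chordal p9free
    ((_     ∷ _     ∷ false ∷ false ∷ []) ∷
     (_     ∷ _     ∷ false ∷ true  ∷ []) ∷
     (_     ∷ _     ∷ _     ∷ _     ∷ []) ∷
     (_     ∷ _     ∷ _     ∷ _     ∷ []) ∷ []) (refl , refl , refl , refl) realised =
    cycleIn chordal realised (left 0F ∷ left 1F ∷ left 2F ∷ right 4F ∷ right 3F ∷ right 2F ∷ right 1F ∷ []) tt
  glued chordal p9free
    ((_     ∷ _     ∷ false ∷ _     ∷ []) ∷
     (_     ∷ _     ∷ false ∷ _     ∷ []) ∷
     (false ∷ false ∷ false ∷ _     ∷ []) ∷
     (false ∷ false ∷ true  ∷ _     ∷ []) ∷ []) (refl , refl , refl , refl) realised =
    cycleIn chordal realised (left 0F ∷ left 1F ∷ left 2F ∷ left 3F ∷ left 4F ∷ right 3F ∷ right 2F ∷ right 1F ∷ []) tt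
  glued chordal p9free
    ((_     ∷ _     ∷ false ∷ false ∷ []) ∷
     (_     ∷ _     ∷ false ∷ false ∷ []) ∷
     (false ∷ false ∷ false ∷ true  ∷ []) ∷
     (_     ∷ _     ∷ _     ∷ _     ∷ []) ∷ []) (refl , refl , refl , refl) realised =
    cycleIn chordal realised (left 0F ∷ left 1F ∷ left 2F ∷ left 3F ∷ right 4F ∷ right 3F ∷ right 2F ∷ right 1F ∷ []) tt
  glued chordal p9free
    ((_     ∷ _     ∷ false ∷ false ∷ []) ∷
     (_     ∷ _     ∷ false ∷ false ∷ []) ∷
     (false ∷ false ∷ false ∷ false ∷ []) ∷
     (false ∷ false ∷ false ∷ true  ∷ []) ∷ []) (refl , refl , refl , refl) realised =
    cycleIn chordal realised (left 0F ∷ left 1F ∷ left 2F ∷ left 3F ∷ left 4F ∷ right 4F ∷ right 3F ∷ right 2F ∷ right 1F ∷ []) tt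
  glued chordal p9free
    ((_     ∷ _     ∷ false ∷ false ∷ []) ∷
     (_     ∷ _     ∷ false ∷ false ∷ []) ∷
     (false ∷ false ∷ false ∷ false ∷ []) ∷
     (false ∷ false ∷ false ∷ false ∷ []) ∷ []) (refl , refl , refl , refl) realised =
    pathIn p9free realised (left 4F ∷ left 3F ∷ left 2F ∷ left 1F ∷ left 0F ∷ right 1F ∷ right 2F ∷ right 3F ∷ right 4F ∷ []) tt

  twoTails : Chordal G → P9Free G → ∀ {L R} → InducedPath5 (a ∷ L) → InducedPath5 (a ∷ R) →
    adj G (lookup L 0F) (lookup R 0F) ≡ false → adj G (lookup L 0F) (lookup R 1F) ≡ false →
    adj G (lookup L 1F) (lookup R 0F) ≡ false → adj G (lookup L 1F) (lookup R 1F) ≡ false → ⊥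
  twoTails chordal p9free {L} {R} pL pR n00 n01 n10 n11 =
    glued chordal p9free (crossMatrix L R) (n00 , n01 , n10 , n11) (realisesGlued pL pR)

  module Irredundant {IR : VSet G} (isIR : IsIRChoice G IR) where
    open IsIRChoice isIR

    IR? : ∀ x → Dec (IR x)
    IR? x with minimal? x
    ... | no ¬minimal = no λ ix → ¬minimal (ir-minimal x ix)
    ... | yes minimal with ir-covers x minimal
    ... | y , iy , same with y ≟ x
    ... | yes refl = yes iy
    ... | no y≢x = no λ ix → y≢x (ir-unique y x iy ix same)

    incomparable : IR x → IR y → x ≢ y → ¬ N[ y ]⊆N[ x ]
    incomparable {x = x} {y = y} ix iy x≢y y⊆x =
      x≢y (ir-unique x y ix iy (ir-minimal x ix y y⊆x , y⊆x))

    -- An irredundant edge xy with a ~ x, a ≁ y and a ≠ y extends to an induced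
    -- path a–x–y–y₁–z: y₁ is a private neighbour of y against x, z one of y₁
    -- against y, and chordality rules out the remaining chords.
    extend : Chordal G → IR x → IR y → Adj G x y → Adj G a x → ¬ Adj G a y → a ≢ y →
      ∃₂ λ y₁ z → InducedPath5 (a ∷ x ∷ y ∷ y₁ ∷ z ∷ [])
    extend {x = x} {y = y} {a = a} chordal ix iy xy ax ¬ay a≢y
      with privateNeighbour (inj₂ xy) (incomparable ix iy (adjacent⇒distinct xy))
    ... | y₁ , yy₁ , x≢y₁ , ¬xy₁
      with privateNeighbour (inj₂ yy₁)
             (minimal⇒notBelow (ir-minimal y iy) (inj₂ (swap xy)) (outsideNC x≢y₁ ¬xy₁))
    ... | z , y₁z , y≢z , ¬yz = y₁ , z , chordalPath5 chordal {v = a ∷ x ∷ y ∷ y₁ ∷ z ∷ []}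
          (realisesPath5 a x y y₁ z ax xy yy₁ y₁z
             (¬-not ¬ay) (¬-not ¬ay₁) (¬-not ¬xy₁) (¬-not ¬xz) (¬-not ¬yz) refl)
      where
        ¬ay₁ : ¬ Adj G a y₁
        ¬ay₁ ay₁ = noInducedC4 chordal a≢y x≢y₁ ax xy yy₁ (swap ay₁) (¬-not ¬ay) (¬-not ¬xy₁)
        ¬xz : ¬ Adj G x z
        ¬xz xz = noInducedC4 chordal x≢y₁ y≢z xy yy₁ y₁z (swap xz) (¬-not ¬xy₁) (¬-not ¬yz)

    -- Boundary edges of a redundant vertex a at the irredundant components of r
    -- and r′ either touch, joining the components, or give two clashing tails.
    boundaryEdgesMeet : Chordal G → P9Free G → ¬ IR a →
      BoundaryEdge IR a r → BoundaryEdge IR a r′ → WalkIn G IR r r′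
    boundaryEdgesMeet chordal p9free a∉IR
      (x , y , rx , ry , xy , ax , ¬ay) (x′ , y′ , r′x′ , r′y′ , x′y′ , ax′ , ¬ay′)
      with adj? x x′ | adj? x y′ | adj? y x′ | adj? y y′
    ... | yes e | _     | _     | _     = joinAt rx r′x′ e
    ... | no _  | yes e | _     | _     = joinAt rx r′y′ e
    ... | no _  | no _  | yes e | _     = joinAt ry r′x′ e
    ... | no _  | no _  | no _  | yes e = joinAt ry r′y′ e
    ... | no ¬xx′ | no ¬xy′ | no ¬yx′ | no ¬yy′
      with extend chordal (walkEnd rx) (walkEnd ry) xy ax ¬ay (a∉IR ∘ λ { refl → walkEnd ry })
         | extend chordal (walkEnd r′x′) (walkEnd r′y′) x′y′ ax′ ¬ay′ (a∉IR ∘ λ { refl → walkEnd r′y′ })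
    ... | _ , _ , leftTail | _ , _ , rightTail =
      ⊥-elim (twoTails chordal p9free leftTail rightTail (¬-not ¬xx′) (¬-not ¬xy′) (¬-not ¬yx′) (¬-not ¬yy′))

proposition8 : (G : Graph) → P9Free G → Chordal G →
    (IR : VSet G) → IsIRChoice G IR →
    (a : Vertex G) → ¬ IR a →
    (r₁ r₂ : Vertex G) → IR r₁ → IR r₂ →
    PartiallyAdjacent G a (ComponentOf G IR r₁) →
    PartiallyAdjacent G a (ComponentOf G IR r₂) →
    WalkIn G IR r₁ r₂
proposition8 G p9free chordal IR isIR a a∉IR r₁ r₂ _ _ partial₁ partial₂ =
  boundaryEdgesMeet chordal p9free a∉IR (boundaryEdge G IR? partial₁) (boundaryEdge G IR? partial₂)
  where open Irredundant G isIR
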